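{- Let $a,b,c$ be nonzero integers and let $\mathcal{E}$ denote the equation $ax+by+cz=0$. Suppose $\mathcal{E}$ is not regular and that for some prime $p$, $$0=v_p(a)<v_p(b)=v_p(c)=v_p(b+c)=:r.$$ Then $dor(\mathcal{E})<6$. Write $b=p^rb'$ and $c=p^rc'$. If additionally the element $g:=-b'c'^{ -1}$ of the multiplicative group $(\mathbb{Z}/p^r\mathbb{Z})^\times$ has even order, then $dor(\mathcal{E})<4$.
   Context: For a prime $p$ and nonzero integer $x$, $v_p(x)$ is the largest integer $n$ with $p^n\mid x$. A linear equation $\mathcal{E}$ is $k$-regular if every coloring of the positive integers with $k$ colors admits a monochromatic solution to $\mathcal{E}$ in positive integers; it is regular if it is $k$-regular for every $k\ge1$. The degree of regularity $dor(\mathcal{E})$ is the largest $k$ for which $\mathcal{E}$ is $k$-regular ($\infty$ if regular). -}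

module Defs where

open import Data.Nat as ℕ using (ℕ; suc; _<_; _≤_; _^_)
open import Data.Integer as ℤ using (ℤ; +_; 0ℤ; 1ℤ; _+_; _*_; _-_; -_)
open import Data.Integer.Divisibility using (_∣_)
open import Data.Fin using (Fin)
open import Data.Product using (Σ; _×_; ∃)
open import Relation.Binary.PropositionalEquality using (_≡_)
open import Relation.Nullary using (¬_)

infixr 8 _^ℤ_
_^ℤ_ : ℤ → ℕ → ℤ
x ^ℤ 0 = 1ℤ
x ^ℤ suc n = x * (x ^ℤ n)

-- v_p(x) = n  (for x ≠ 0 this pins down n; for x = 0 no n satisfies it)
HasVal : ℕ → ℤ → ℕ → Set
HasVal p x n = (+ (p ^ n) ∣ x) × ¬ (+ (p ^ suc n) ∣ x)

MonoSol : ℤ → ℤ → ℤ → {k : ℕ} → (ℕ → Fin k) → Set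
MonoSol a b c col =
  Σ ℕ λ x → Σ ℕ λ y → Σ ℕ λ z →
    (0 < x) × (0 < y) × (0 < z) ×
    (col x ≡ col y) × (col y ≡ col z) ×
    (a * + x + b * + y + c * + z ≡ 0ℤ)

-- k-regular: every k-colouring of the positive integers (values at 0 are irrelevant)
-- admits a monochromatic solution
KRegular : ℤ → ℤ → ℤ → ℕ → Set
KRegular a b c k = (col : ℕ → Fin k) → MonoSol a b c col

Regular : ℤ → ℤ → ℤ → Set
Regular a b c = ∀ k → 1 ≤ k → KRegular a b c k

DorLt : ℤ → ℤ → ℤ → ℕ → Set
DorLt a b c n = ∀ k → 1 ≤ k → KRegular a b c k → k < n

IsOrderMod : ℕ → ℤ → ℕ → Set
IsOrderMod m g e =
  (0 < e) × (+ m ∣ (g ^ℤ e - 1ℤ)) ×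
  (∀ j → 0 < j → j < e → ¬ (+ m ∣ (g ^ℤ j - 1ℤ)))

-- Write n = pᵛ u with p ∤ u and colour n by the parity of ⌊v / r⌋ together with a colour
-- χ(u mod p). In a monochromatic solution the three terms of a x + b y + c z have valuations
-- v_x, r + v_y, r + v_z; equal parities of the layers rule out v_x = r + v_y and v_x = r + v_z, and
-- since the least valuation occurs twice, v_y = v_z and p ∣ b′ Y + c′ Z, i.e. Z ≡ g Y (mod p) for
-- g ≡ -b′ / c′. So it suffices that χ(g Y) ≠ χ(Y) for every unit Y: a proper colouring of the
-- orbits of Y ↦ g Y, which are cycles of length d = ord_p(g). Numbering each orbit backwards from
-- its least residue turns multiplication by g into j ↦ j - 1 (mod d); three colours suffice as
-- d ≠ 1 (p ∤ b′ + c′), and two when d is even, which follows from the order of g mod pʳ being even.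

module Submission where

open import Defs
open import Data.Nat as ℕ using (ℕ; _<_; _^_)
open import Data.Nat.Primality using (Prime)
open import Data.Nat.Primality using (euclidsLemma; prime⇒nonZero; prime⇒nonTrivial; prime[2])
open import Data.Nat.Divisibility as ℕD using ()
open import Data.Integer as ℤ using (ℤ; +_; 0ℤ; _+_; _*_; -_)
open import Data.Integer.Divisibility using (_∣_)
open import Data.Product using (Σ; _×_)
open import Relation.Binary.PropositionalEquality using (_≡_; _≢_)
open import Relation.Nullary using (¬_)

open import Data.Nat using (zero; suc; _≤_; z≤n; s≤s; NonZero; nonTrivial⇒≢1)
import Data.Nat.Properties as ℕ
open import Data.Integer using (1ℤ; _-_)
import Data.Integer.Properties as ℤ
import Data.Integer.Divisibility.Signed as S
import Data.Integer.DivMod as ℤD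
import Data.Nat.DivMod as ℕ
open import Data.Integer.Tactic.RingSolver using (solve-∀)
open import Data.Product using (_,_; proj₁; proj₂; ∃; ∃₂)
open import Data.Sum using (_⊎_; inj₁; inj₂)
import Data.Sum as Sum
open import Data.Fin using (Fin)
import Data.Fin as Fin
import Data.Fin.Properties as Fin
open import Data.Empty using (⊥-elim)
open import Relation.Binary.PropositionalEquality using (refl; sym; trans; cong; cong₂; subst; subst₂; module ≡-Reasoning)
open import Relation.Binary.Definitions using (tri<; tri≈; tri>)
open import Relation.Nullary using (Dec; yes; no; contradiction)
import Relation.Nullary.Decidable as Dec
open import Relation.Unary using (Pred; Decidable)
open import Level using (0ℓ)
open import Data.Nat.Induction using (<-rec)
open import Function using (_∘′_; id; flip)
open import Relation.Binary.Structures using (IsEquivalence)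
open import Relation.Binary.Bundles using (Setoid)

record Least (P : Pred ℕ 0ℓ) : Set where
  constructor least
  field
    value   : ℕ
    holds   : P value
    minimal : ∀ {i} → i < value → ¬ P i

open Least using (value)

module _ {P : Pred ℕ 0ℓ} where

  least-unique : (l l′ : Least P) → value l ≡ value l′
  least-unique (least m pm min-m) (least n pn min-n) with ℕ.<-cmp m n
  ... | tri< m<n _ _ = contradiction pm (min-n m<n)
  ... | tri≈ _ m≡n _ = m≡n
  ... | tri> _ _ n<m = contradiction pn (min-m n<m)

  least-map : ∀ {Q : Pred ℕ 0ℓ} → (∀ {i} → P i → Q i) → (∀ {i} → Q i → P i) → Least P → Least Q
  least-map P⇒Q Q⇒P (least v pv min-v) = least v (P⇒Q pv) (λ i<v → min-v i<v ∘′ Q⇒P)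

  module _ (P? : Decidable P) where

    private
      search : ∀ k n → (∀ {i} → i < k → ¬ P i) → P (n ℕ.+ k) → Least P
      search k zero    below pk = least k pk below
      search k (suc n) below pk with P? k
      ... | yes pk′ = least k pk′ below
      ... | no ¬pk  = search (suc k) n below′ (subst P (sym (ℕ.+-suc n k)) pk)
        where
        below′ : ∀ {i} → i < suc k → ¬ P i
        below′ {i} i<1+k with i ℕ.≟ k
        ... | yes refl = ¬pk
        ... | no i≢k   = below (ℕ.≤∧≢⇒< (ℕ.≤-pred i<1+k) i≢k)

    -- Opaque: letting unification unfold the search makes type checking explode.
    opaque
      least-from : ∀ {n} → P n → Least P
      least-from {n} pn = search 0 n (λ ()) (subst P (sym (ℕ.+-identityʳ n)) pn)

record PSplit (p n : ℕ) : Set where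
  field
    exponent : ℕ
    cofactor : ℕ
    splits   : n ≡ p ^ exponent ℕ.* cofactor
    coprime  : ¬ p ℕD.∣ cofactor

opaque
  p-split : ∀ {p} → 1 < p → ∀ n → 0 < n → PSplit p n
  p-split {p} 1<p = <-rec (λ n → 0 < n → PSplit p n) step
    where
    step : ∀ n → (∀ {m} → m < n → 0 < m → PSplit p m) → 0 < n → PSplit p n
    step n _ _ with p ℕD.∣? n
    step n _ _ | no p∤n = record
      { exponent = 0 ; cofactor = n ; splits = sym (ℕ.+-identityʳ n) ; coprime = p∤n }
    step n split-below 0<n | yes (ℕD.divides q n≡q*p) = record
      { exponent = suc exponent ; cofactor = cofactor ; splits = n≡pᵉ⁺¹*u ; coprime = coprime }
      where
      0<q : 0 < q
      0<q = ℕ.n≢0⇒n>0 λ { refl → ℕ.<⇒≢ 0<n (sym n≡q*p) }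
      q<n : q < n
      q<n = subst (q <_) (sym n≡q*p) (ℕ.m<m*n q p {{ℕ.>-nonZero 0<q}} 1<p)
      open PSplit (split-below q<n 0<q)
      n≡pᵉ⁺¹*u : n ≡ p ^ suc exponent ℕ.* cofactor
      n≡pᵉ⁺¹*u = begin
        n                                 ≡⟨ n≡q*p ⟩
        q ℕ.* p                           ≡⟨ cong (ℕ._* p) splits ⟩
        p ^ exponent ℕ.* cofactor ℕ.* p   ≡⟨ ℕ.*-comm _ p ⟩
        p ℕ.* (p ^ exponent ℕ.* cofactor) ≡⟨ ℕ.*-assoc p _ cofactor ⟨
        p ^ suc exponent ℕ.* cofactor     ∎
        where open ≡-Reasoning

-- Proper colourings of a cycle

-- i ≡ j - 1 (mod d), for residues 0 ≤ i, j < d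
CyclicPredecessor : ℕ → ℕ → ℕ → Set
CyclicPredecessor d i j = suc i ≡ j ⊎ (j ≡ 0 × suc i ≡ d)

mod-2-injective : ∀ m n → m ℕ.mod 2 ≡ n ℕ.mod 2 → m ℕ.% 2 ≡ n ℕ.% 2
mod-2-injective m n eq = begin
  m ℕ.% 2               ≡⟨ Fin.toℕ-fromℕ< (ℕ.m%n<n m 2) ⟨
  Fin.toℕ (m ℕ.mod 2)    ≡⟨ cong Fin.toℕ eq ⟩
  Fin.toℕ (n ℕ.mod 2)    ≡⟨ Fin.toℕ-fromℕ< (ℕ.m%n<n n 2) ⟩
  n ℕ.% 2               ∎
  where open ≡-Reasoning

suc-%-2 : ∀ n → suc n ℕ.% 2 ≢ n ℕ.% 2
suc-%-2 zero    ()
suc-%-2 (suc n) eq = suc-%-2 n (sym (trans (sym (ℕ.[m+n]%n≡m%n n 2)) (trans (cong (ℕ._% 2) (ℕ.+-comm n 2)) eq)))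

suc-mod-2 : ∀ n → suc n ℕ.mod 2 ≢ n ℕ.mod 2
suc-mod-2 n = suc-%-2 n ∘′ mod-2-injective (suc n) n

parity-proper : ∀ {d i j} → 2 ℕD.∣ d → CyclicPredecessor d i j → i ℕ.mod 2 ≢ j ℕ.mod 2
parity-proper {i = i} _ (inj₁ refl) = suc-mod-2 i ∘′ sym
parity-proper {d} {i} 2∣d (inj₂ (refl , 1+i≡d)) iₘ≡0ₘ =
  suc-%-2 i (trans (cong (ℕ._% 2) 1+i≡d) (trans (ℕD.n∣m⇒m%n≡0 d 2 2∣d) (sym (mod-2-injective i 0 iₘ≡0ₘ))))

cycle-colour : ℕ → ℕ → Fin 3
cycle-colour d j with suc j ℕ.≟ d
... | yes _ = Fin.fromℕ 2
... | no  _ = Fin.inject₁ (j ℕ.mod 2)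

cycle-colour-proper : ∀ {d i j} → d ≢ 1 → CyclicPredecessor d i j → cycle-colour d i ≢ cycle-colour d j
cycle-colour-proper {d} {i} _ (inj₁ refl) with suc i ℕ.≟ d | suc (suc i) ℕ.≟ d
... | yes refl | yes eq  = contradiction (sym eq) (ℕ.<⇒≢ (ℕ.n<1+n (suc i)))
... | yes _    | no  _   = Fin.fromℕ≢inject₁
... | no  _    | yes _   = Fin.fromℕ≢inject₁ ∘′ sym
... | no  _    | no  _   = suc-mod-2 i ∘′ sym ∘′ Fin.inject₁-injective
cycle-colour-proper {d} {i} d≢1 (inj₂ (refl , 1+i≡d)) with suc i ℕ.≟ d | 1 ℕ.≟ d
... | _        | yes 1≡d = contradiction (sym 1≡d) d≢1
... | yes _    | no  _   = Fin.fromℕ≢inject₁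
... | no 1+i≢d | no  _   = contradiction 1+i≡d 1+i≢d

^ℤ≗^ : ∀ x n → x ^ℤ n ≡ x ℤ.^ n
^ℤ≗^ x zero    = refl
^ℤ≗^ x (suc n) = cong (x *_) (^ℤ≗^ x n)

^ℤ-distribˡ-+-* : ∀ x m n → x ^ℤ (m ℕ.+ n) ≡ x ^ℤ m * x ^ℤ n
^ℤ-distribˡ-+-* x m n
  rewrite ^ℤ≗^ x (m ℕ.+ n) | ^ℤ≗^ x m | ^ℤ≗^ x n = ℤ.^-distribˡ-+-* x m n

^ℤ-*-assoc : ∀ x m n → (x ^ℤ m) ^ℤ n ≡ x ^ℤ (m ℕ.* n)
^ℤ-*-assoc x m n
  rewrite ^ℤ≗^ (x ^ℤ m) n | ^ℤ≗^ x m | ^ℤ≗^ x (m ℕ.* n) = ℤ.^-*-assoc x m n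

^ℤ-zeroˡ : ∀ n → 1ℤ ^ℤ n ≡ 1ℤ
^ℤ-zeroˡ n rewrite ^ℤ≗^ 1ℤ n = ℤ.^-zeroˡ n

-- Congruence modulo m

module Congruence (m : ℕ) where

  infix 4 _≈_ _≈?_

  record _≈_ (x y : ℤ) : Set where
    constructor mk≈
    field ∣-difference : + m S.∣ x - y

  open _≈_ public

  _≈?_ : ∀ x y → Dec (x ≈ y)
  x ≈? y = Dec.map′ mk≈ ∣-difference (+ m S.∣? x - y)

  ≈-reflexive : ∀ {x y} → x ≡ y → x ≈ y
  ≈-reflexive {x} refl = mk≈ (S.divides 0ℤ (ℤ.+-inverseʳ x))

  ≈-refl : ∀ {x} → x ≈ x
  ≈-refl = ≈-reflexive refl

  ≈-sym : ∀ {x y} → x ≈ y → y ≈ x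
  ≈-sym {x} {y} (mk≈ m∣x-y) = mk≈ (subst (+ m S.∣_) (negate x y) (S.∣m⇒∣-m m∣x-y))
    where
    negate : ∀ x y → - (x - y) ≡ y - x
    negate = solve-∀

  ≈-trans : ∀ {x y z} → x ≈ y → y ≈ z → x ≈ z
  ≈-trans {x} {y} {z} (mk≈ m∣x-y) (mk≈ m∣y-z) =
    mk≈ (subst (+ m S.∣_) (telescope x y z) (S.∣m∣n⇒∣m+n m∣x-y m∣y-z))
    where
    telescope : ∀ x y z → (x - y) + (y - z) ≡ x - z
    telescope = solve-∀

  ≈-isEquivalence : IsEquivalence _≈_
  ≈-isEquivalence = record { refl = ≈-refl ; sym = ≈-sym ; trans = ≈-trans }

  ≈-setoid : Setoid 0ℓ 0ℓ
  ≈-setoid = record { isEquivalence = ≈-isEquivalence }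

  +-cong : ∀ {x x′ y y′} → x ≈ x′ → y ≈ y′ → x + y ≈ x′ + y′
  +-cong {x} {x′} {y} {y′} (mk≈ m∣x-x′) (mk≈ m∣y-y′) =
    mk≈ (subst (+ m S.∣_) (regroup x x′ y y′) (S.∣m∣n⇒∣m+n m∣x-x′ m∣y-y′))
    where
    regroup : ∀ x x′ y y′ → (x - x′) + (y - y′) ≡ (x + y) - (x′ + y′)
    regroup = solve-∀

  *-congˡ : ∀ z {x y} → x ≈ y → z * x ≈ z * y
  *-congˡ z {x} {y} (mk≈ m∣x-y) = mk≈ (subst (+ m S.∣_) (distrib z x y) (S.∣n⇒∣m*n z m∣x-y))
    where
    distrib : ∀ z x y → z * (x - y) ≡ z * x - z * y
    distrib = solve-∀

  *-congʳ : ∀ z {x y} → x ≈ y → x * z ≈ y * z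
  *-congʳ z {x} {y} x≈y = subst₂ _≈_ (ℤ.*-comm z x) (ℤ.*-comm z y) (*-congˡ z x≈y)

  *-cong : ∀ {x x′ y y′} → x ≈ x′ → y ≈ y′ → x * y ≈ x′ * y′
  *-cong {x′ = x′} {y = y} x≈x′ y≈y′ = ≈-trans (*-congʳ y x≈x′) (*-congˡ x′ y≈y′)

  ^-cong : ∀ {x y} n → x ≈ y → x ^ℤ n ≈ y ^ℤ n
  ^-cong zero    x≈y = ≈-refl
  ^-cong (suc n) x≈y = *-cong x≈y (^-cong n x≈y)

  ∣⇒≈0 : ∀ {x} → + m S.∣ x → x ≈ 0ℤ
  ∣⇒≈0 {x} m∣x = mk≈ (subst (+ m S.∣_) (sym (ℤ.+-identityʳ x)) m∣x)

  ≈0⇒∣ : ∀ {x} → x ≈ 0ℤ → + m S.∣ x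
  ≈0⇒∣ {x} (mk≈ m∣x-0) = subst (+ m S.∣_) (ℤ.+-identityʳ x) m∣x-0

  ≈1⇒^≈1 : ∀ {x} n → x ≈ 1ℤ → x ^ℤ n ≈ 1ℤ
  ≈1⇒^≈1 n x≈1 = ≈-trans (^-cong n x≈1) (≈-reflexive (^ℤ-zeroˡ n))

  ≈-%ℕ : ∀ x .{{_ : NonZero m}} → x ≈ + (x ℤ.%ℕ m)
  ≈-%ℕ x = mk≈ (S.divides (x ℤ./ℕ m) (begin
    x - + (x ℤ.%ℕ m)                                  ≡⟨ cong (_- + (x ℤ.%ℕ m)) (ℤD.a≡a%ℕn+[a/ℕn]*n x m) ⟩
    + (x ℤ.%ℕ m) + (x ℤ./ℕ m) * + m - + (x ℤ.%ℕ m)   ≡⟨ cancel (+ (x ℤ.%ℕ m)) ((x ℤ./ℕ m) * + m) ⟩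
    (x ℤ./ℕ m) * + m                                  ∎))
    where
    open ≡-Reasoning
    cancel : ∀ r q → r + q - r ≡ q
    cancel = solve-∀

  record IsOrder (g : ℤ) (d : ℕ) : Set where
    field
      positive : 0 < d
      returns  : g ^ℤ d ≈ 1ℤ
      minimal  : ∀ {j} → 0 < j → j < d → ¬ g ^ℤ j ≈ 1ℤ

  order≢1 : ∀ {g d} → IsOrder g d → ¬ g ≈ 1ℤ → d ≢ 1
  order≢1 {g} ord g≉1 refl = g≉1 (≈-trans (≈-reflexive (sym (ℤ.*-identityʳ g))) (IsOrder.returns ord))

  order-divides : ∀ {g d n} → IsOrder g d → g ^ℤ n ≈ 1ℤ → d ℕD.∣ n
  order-divides {g} {d} {n} ord gⁿ≈1 = ℕD.m%n≡0⇒n∣m n d remainder≡0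
    where
    open IsOrder ord
    instance
      d≢0 : NonZero d
      d≢0 = ℕ.>-nonZero positive
    open import Relation.Binary.Reasoning.Setoid ≈-setoid
    r q : ℕ
    r = n ℕ.% d
    q = n ℕ./ d
    gʳ≈1 : g ^ℤ r ≈ 1ℤ
    gʳ≈1 = begin
      g ^ℤ r                       ≡⟨ ℤ.*-identityʳ (g ^ℤ r) ⟨
      g ^ℤ r * 1ℤ                  ≈⟨ *-congˡ (g ^ℤ r) (≈1⇒^≈1 q returns) ⟨
      g ^ℤ r * (g ^ℤ d) ^ℤ q       ≡⟨ cong (g ^ℤ r *_) (^ℤ-*-assoc g d q) ⟩
      g ^ℤ r * g ^ℤ (d ℕ.* q)      ≡⟨ ^ℤ-distribˡ-+-* g r (d ℕ.* q) ⟨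
      g ^ℤ (r ℕ.+ d ℕ.* q)         ≡⟨ cong (λ k → g ^ℤ (r ℕ.+ k)) (ℕ.*-comm d q) ⟩
      g ^ℤ (r ℕ.+ q ℕ.* d)         ≡⟨ cong (g ^ℤ_) (ℕ.m≡m%n+[m/n]*n n d) ⟨
      g ^ℤ n                       ≈⟨ gⁿ≈1 ⟩
      1ℤ                           ∎
    remainder≡0 : n ℕ.% d ≡ 0
    remainder≡0 with n ℕ.% d in r≡
    ... | zero  = refl
    ... | suc _ = contradiction (subst (λ r → g ^ℤ r ≈ 1ℤ) r≡ gʳ≈1)
                                (minimal (s≤s z≤n) (subst (_< d) r≡ (ℕ.m%n<n n d)))

module ModPrime {p : ℕ} (p-prime : Prime p) where

  open Congruence p public

  instance
    p≢0 : NonZero p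
    p≢0 = prime⇒nonZero p-prime

  1<p : 1 < p
  1<p = ℕ.nonTrivial⇒n>1 p {{prime⇒nonTrivial p-prime}}

  euclidsLemmaℤ : ∀ x y → + p S.∣ x * y → + p S.∣ x ⊎ + p S.∣ y
  euclidsLemmaℤ x y p∣xy =
    Sum.map S.∣ᵤ⇒∣ S.∣ᵤ⇒∣
      (euclidsLemma ℤ.∣ x ∣ ℤ.∣ y ∣ p-prime (subst (p ℕD.∣_) (ℤ.abs-* x y) (S.∣⇒∣ᵤ p∣xy)))

  ∤-* : ∀ {x y} → ¬ + p S.∣ x → ¬ + p S.∣ y → ¬ + p S.∣ x * y
  ∤-* {x} {y} p∤x p∤y p∣xy = Sum.[ p∤x , p∤y ]′ (euclidsLemmaℤ x y p∣xy)

  ∤-^ : ∀ {x} n → ¬ + p S.∣ x → ¬ + p S.∣ x ^ℤ n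
  ∤-^ zero    p∤x p∣1 = nonTrivial⇒≢1 {{prime⇒nonTrivial p-prime}} (ℕD.∣1⇒≡1 (S.∣⇒∣ᵤ p∣1))
  ∤-^ (suc n) p∤x     = ∤-* p∤x (∤-^ n p∤x)

  *-cancelʳ-≈ : ∀ {x y z} → ¬ + p S.∣ z → x * z ≈ y * z → x ≈ y
  *-cancelʳ-≈ {x} {y} {z} p∤z (mk≈ p∣xz-yz) =
    Sum.[ mk≈ , flip contradiction p∤z ]′
      (euclidsLemmaℤ (x - y) z (subst (+ p S.∣_) (factor x y z) p∣xz-yz))
    where
    factor : ∀ x y z → x * z - y * z ≡ (x - y) * z
    factor = solve-∀

  -- pigeonhole on the residues of x⁰, …, xᵖ
  period : ∀ {x} → ¬ + p S.∣ x → ∃ λ n → x ^ℤ suc n ≈ 1ℤ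
  period {x} p∤x = n , xⁿ⁺¹≈1
    where
    residue : Fin (suc p) → Fin p
    residue k = Fin.fromℕ< (ℤD.n%ℕd<d (x ^ℤ Fin.toℕ k) p)
    collision : ∃₂ λ i j → i Fin.< j × residue i ≡ residue j
    collision = Fin.pigeonhole (ℕ.n<1+n p) residue
    i j : ℕ
    i = Fin.toℕ (proj₁ collision)
    j = Fin.toℕ (proj₁ (proj₂ collision))
    n : ℕ
    n = j ℕ.∸ suc i
    j≡1+n+i : j ≡ suc n ℕ.+ i
    j≡1+n+i = trans (sym (ℕ.m∸n+n≡m (proj₁ (proj₂ (proj₂ collision))))) (ℕ.+-suc n i)
    residues-equal : x ^ℤ i ℤ.%ℕ p ≡ x ^ℤ j ℤ.%ℕ p
    residues-equal = Fin.fromℕ<-injective _ _ _ _ (proj₂ (proj₂ (proj₂ collision)))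
    open import Relation.Binary.Reasoning.Setoid ≈-setoid
    xⁿ⁺¹≈1 : x ^ℤ suc n ≈ 1ℤ
    xⁿ⁺¹≈1 = ≈-sym (*-cancelʳ-≈ (∤-^ i p∤x) (begin
      1ℤ * x ^ℤ i              ≡⟨ ℤ.*-identityˡ (x ^ℤ i) ⟩
      x ^ℤ i                   ≈⟨ ≈-%ℕ (x ^ℤ i) ⟩
      + (x ^ℤ i ℤ.%ℕ p)        ≡⟨ cong +_ residues-equal ⟩
      + (x ^ℤ j ℤ.%ℕ p)        ≈⟨ ≈-%ℕ (x ^ℤ j) ⟨
      x ^ℤ j                   ≡⟨ cong (x ^ℤ_) j≡1+n+i ⟩
      x ^ℤ (suc n ℕ.+ i)       ≡⟨ ^ℤ-distribˡ-+-* x (suc n) i ⟩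
      x ^ℤ suc n * x ^ℤ i      ∎))

  order : ∀ {x} → ¬ + p S.∣ x → ∃ (IsOrder x)
  order {x} p∤x = suc (value l) , record
    { positive = s≤s z≤n
    ; returns  = Least.holds l
    ; minimal  = below
    }
    where
    l : Least (λ k → x ^ℤ suc k ≈ 1ℤ)
    l = let n , xⁿ⁺¹≈1 = period p∤x in least-from (λ k → x ^ℤ suc k ≈? 1ℤ) {n} xⁿ⁺¹≈1
    below : ∀ {j} → 0 < j → j < suc (value l) → ¬ x ^ℤ j ≈ 1ℤ
    below {suc j} _ (s≤s j<v) = Least.minimal l j<v

  p∣2⇒unit≈1 : + p S.∣ + 2 → ∀ {x} → ¬ + p S.∣ x → x ≈ 1ℤ
  p∣2⇒unit≈1 p∣2 {x} p∤x = ≈-trans (≈-%ℕ x) (≈-reflexive (cong +_ residue≡1))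
    where
    residue≡1 : x ℤ.%ℕ p ≡ 1
    residue≡1 with x ℤ.%ℕ p in r≡ | ℤD.n%ℕd<d x p
    ... | zero        | _ = contradiction (≈0⇒∣ (≈-trans (≈-%ℕ x) (≈-reflexive (cong +_ r≡)))) p∤x
    ... | suc zero    | _ = refl
    ... | suc (suc _) | 2<p =
      contradiction (ℕD.∣⇒≤ (S.∣⇒∣ᵤ p∣2)) (ℕ.<⇒≱ (ℕ.≤-trans (s≤s (s≤s (s≤s z≤n))) 2<p))

  p^-suc : ∀ n → + (p ^ suc n) ≡ + p * + (p ^ n)
  p^-suc n = ℤ.pos-* p (p ^ n)

  p^-sucʳ : ∀ n → + (p ^ suc n) ≡ + (p ^ n) * + p
  p^-sucʳ n = trans (p^-suc n) (ℤ.*-comm (+ p) (+ (p ^ n)))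

  p∣p^ : ∀ {n} → 0 < n → + p S.∣ + (p ^ n)
  p∣p^ {suc n} _ = S.divides (+ (p ^ n)) (p^-sucʳ n)

  cofactor-coprime : ∀ {r x x′} → HasVal p x r → x ≡ + (p ^ r) * x′ → ¬ + p S.∣ x′
  cofactor-coprime {r} {x′ = x′} (_ , pʳ⁺¹∤x) refl p∣x′ =
    pʳ⁺¹∤x (S.∣⇒∣ᵤ (subst (S._∣ + (p ^ r) * x′) (sym (p^-sucʳ r))
                           (S.*-monoʳ-∣ (+ (p ^ r)) p∣x′)))

  prime^-divisor : ∀ r {x y} → ¬ + p S.∣ y → + (p ^ r) S.∣ x * y → + (p ^ r) S.∣ x
  prime^-divisor zero    {x} _ _ = S.divides x (sym (ℤ.*-identityʳ x))
  prime^-divisor (suc r) {x} {y} p∤y pʳ⁺¹∣xy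
    with euclidsLemmaℤ x y (S.∣-trans (p∣p^ {suc r} (s≤s z≤n)) pʳ⁺¹∣xy)
  ... | inj₂ p∣y = contradiction p∣y p∤y
  ... | inj₁ (S.divides q refl) = subst₂ S._∣_ (sym (p^-suc r)) (ℤ.*-comm (+ p) q)
                                         (S.*-monoʳ-∣ (+ p) (prime^-divisor r p∤y pʳ∣qy))
    where
    pʳ∣qy : + (p ^ r) S.∣ q * y
    pʳ∣qy = S.*-cancelˡ-∣ (+ p) (subst₂ S._∣_ (p^-suc r) (regroup q (+ p) y) pʳ⁺¹∣xy)
      where
      regroup : ∀ q p y → q * p * y ≡ p * (q * y)
      regroup = solve-∀

  p^[1+α]∣p^α*x⇒p∣x : ∀ α {x} → + (p ^ suc α) S.∣ + (p ^ α) * x → + p S.∣ x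
  p^[1+α]∣p^α*x⇒p∣x α {x} =
    S.*-cancelˡ-∣ (+ (p ^ α)) {{ℕ.m^n≢0 p α}} ∘′ subst (S._∣ + (p ^ α) * x) (p^-sucʳ α)

  p^[1+α]∣p^β*x : ∀ {α β} x → α < β → + (p ^ suc α) S.∣ + (p ^ β) * x
  p^[1+α]∣p^β*x {α} {β} x α<β = S.∣m⇒∣m*n x (S.divides (+ (p ^ (β ℕ.∸ suc α))) split)
    where
    split : + (p ^ β) ≡ + (p ^ (β ℕ.∸ suc α)) * + (p ^ suc α)
    split = trans (cong (λ k → + (p ^ k)) (sym (ℕ.m∸n+n≡m α<β)))
                  (trans (cong +_ (ℕ.^-distribˡ-+-* p (β ℕ.∸ suc α) (suc α)))
                         (ℤ.pos-* (p ^ (β ℕ.∸ suc α)) (p ^ suc α)))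

  lowest-term : ∀ α {A} S → ¬ + p S.∣ A → + (p ^ suc α) S.∣ S → + (p ^ α) * A + S ≢ 0ℤ
  lowest-term α {A} S p∤A p^[1+α]∣S sum≡0 =
    p∤A (p^[1+α]∣p^α*x⇒p∣x α (S.∣m+n∣n⇒∣m divides-sum p^[1+α]∣S))
    where
    divides-sum : + (p ^ suc α) S.∣ + (p ^ α) * A + S
    divides-sum = subst (+ (p ^ suc α) S.∣_) (sym sum≡0) (S.divides 0ℤ refl)

  private
    no-unique-lowest : ∀ {α β γ} {A B C} → ¬ + p S.∣ A → ¬ + p S.∣ B → α ≢ β → β < γ →
                       + (p ^ α) * A + + (p ^ β) * B + + (p ^ γ) * C ≢ 0ℤ
    no-unique-lowest {α} {β} {γ} {A} {B} {C} p∤A p∤B α≢β β<γ sum≡0 with ℕ.<-cmp α β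
    ... | tri< α<β _ _ = lowest-term α (+ (p ^ β) * B + + (p ^ γ) * C) p∤A
      (S.∣m∣n⇒∣m+n (p^[1+α]∣p^β*x B α<β) (p^[1+α]∣p^β*x C (ℕ.<-trans α<β β<γ)))
      (trans (sym (ℤ.+-assoc (+ (p ^ α) * A) _ _)) sum≡0)
    ... | tri≈ _ α≡β _ = α≢β α≡β
    ... | tri> _ _ β<α = lowest-term β (+ (p ^ α) * A + + (p ^ γ) * C) p∤B
      (S.∣m∣n⇒∣m+n (p^[1+α]∣p^β*x A β<α) (p^[1+α]∣p^β*x C β<γ))
      (trans (rotate (+ (p ^ α) * A) (+ (p ^ β) * B) (+ (p ^ γ) * C)) sum≡0)
      where
      rotate : ∀ a b c → b + (a + c) ≡ a + b + c
      rotate = solve-∀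

  -- The least valuation occurs at least twice.
  vanishing-sum : ∀ {α β γ} {A B C} → ¬ + p S.∣ A → ¬ + p S.∣ B → ¬ + p S.∣ C →
                  + (p ^ α) * A + + (p ^ β) * B + + (p ^ γ) * C ≡ 0ℤ →
                  α ≢ β → α ≢ γ → β ≡ γ × + p S.∣ B + C
  vanishing-sum {α} {β} {γ} {A} {B} {C} p∤A p∤B p∤C sum≡0 α≢β α≢γ with ℕ.<-cmp β γ
  ... | tri< β<γ _ _ = contradiction sum≡0 (no-unique-lowest p∤A p∤B α≢β β<γ)
  ... | tri> _ _ γ<β = contradiction (trans (swap (+ (p ^ α) * A) (+ (p ^ γ) * C) (+ (p ^ β) * B)) sum≡0)
                                     (no-unique-lowest p∤A p∤C α≢γ γ<β)
    where
    swap : ∀ a c b → a + c + b ≡ a + b + c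
    swap = solve-∀
  ... | tri≈ _ refl _ with ℕ.<-cmp α β
  ...   | tri< α<β _ _ = contradiction (trans (sym (ℤ.+-assoc (+ (p ^ α) * A) _ _)) sum≡0)
                           (lowest-term α _ p∤A (S.∣m∣n⇒∣m+n (p^[1+α]∣p^β*x B α<β) (p^[1+α]∣p^β*x C α<β)))
  ...   | tri≈ _ α≡β _ = contradiction α≡β α≢β
  ...   | tri> _ _ β<α = refl , p^[1+α]∣p^α*x⇒p∣x β (S.∣m+n∣n⇒∣m divides-sum (p^[1+α]∣p^β*x A β<α))
    where
    divides-sum : + (p ^ suc β) S.∣ + (p ^ β) * (B + C) + + (p ^ α) * A
    divides-sum = subst (+ (p ^ suc β) S.∣_) (trans (sym sum≡0) (regroup (+ (p ^ α)) A (+ (p ^ β)) B C))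
                        (S.divides 0ℤ refl)
      where
      regroup : ∀ a A b B C → a * A + b * B + b * C ≡ b * (B + C) + a * A
      regroup = solve-∀

  -- If the order d of g modulo p were odd, it would divide f = e / 2, so that g^f + 1 ≈ 2 is a unit
  -- and pʳ ∣ g^e - 1 = (g^f - 1)(g^f + 1) would force pʳ ∣ g^f - 1, against the minimality of e.
  even-order : ∀ {r g e d} → 0 < r → ¬ + p S.∣ + 2 → IsOrderMod (p ^ r) g e → 2 ℕD.∣ e →
               IsOrder g d → 2 ℕD.∣ d
  even-order {suc r} {g} {e} {d} _ p∤2 (0<e , pʳ∣gᵉ-1 , minimalʳ) (ℕD.divides f e≡f*2) ord with 2 ℕD.∣? d
  ... | yes 2∣d = 2∣d
  ... | no  2∤d = ⊥-elim (minimalʳ f 0<f f<e (S.∣⇒∣ᵤ (prime^-divisor (suc r) {h - 1ℤ} p∤h+1 pʳ∣[h-1][h+1])))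
    where
    open import Relation.Binary.Reasoning.Setoid ≈-setoid
    gᵉ≈1 : g ^ℤ e ≈ 1ℤ
    gᵉ≈1 = mk≈ (S.∣-trans (p∣p^ {suc r} (s≤s z≤n)) (S.∣ᵤ⇒∣ pʳ∣gᵉ-1))
    q : ℕ
    q = ℕD.quotient (order-divides ord gᵉ≈1)
    e≡q*d : e ≡ q ℕ.* d
    e≡q*d = ℕD.m∣n⇒n≡quotient*m (order-divides ord gᵉ≈1)
    2∣q : 2 ℕD.∣ q
    2∣q = Sum.[ id , flip contradiction 2∤d ]′ (euclidsLemma q d prime[2] (ℕD.divides f (trans (sym e≡q*d) e≡f*2)))
    q′ : ℕ
    q′ = ℕD.quotient 2∣q
    q≡q′*2 : q ≡ q′ ℕ.* 2
    q≡q′*2 = ℕD.m∣n⇒n≡quotient*m 2∣q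
    f≡q′*d : f ≡ q′ ℕ.* d
    f≡q′*d = ℕ.*-cancelʳ-≡ f (q′ ℕ.* d) 2
      (trans (sym e≡f*2) (trans e≡q*d (trans (cong (ℕ._* d) q≡q′*2) (swap-2 q′ d))))
      where
      swap-2 : ∀ m n → m ℕ.* 2 ℕ.* n ≡ m ℕ.* n ℕ.* 2
      swap-2 m n = trans (ℕ.*-assoc m 2 n) (trans (cong (m ℕ.*_) (ℕ.*-comm 2 n)) (sym (ℕ.*-assoc m n 2)))
    h : ℤ
    h = g ^ℤ f
    h≈1 : h ≈ 1ℤ
    h≈1 = begin
      g ^ℤ f               ≡⟨ cong (g ^ℤ_) (trans f≡q′*d (ℕ.*-comm q′ d)) ⟩
      g ^ℤ (d ℕ.* q′)      ≡⟨ ^ℤ-*-assoc g d q′ ⟨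
      (g ^ℤ d) ^ℤ q′       ≈⟨ ≈1⇒^≈1 q′ (IsOrder.returns ord) ⟩
      1ℤ                   ∎
    p∤h+1 : ¬ + p S.∣ h + 1ℤ
    p∤h+1 p∣h+1 = p∤2 (≈0⇒∣ (begin
      + 2          ≡⟨⟩
      1ℤ + 1ℤ      ≈⟨ +-cong h≈1 ≈-refl ⟨
      h + 1ℤ       ≈⟨ ∣⇒≈0 p∣h+1 ⟩
      0ℤ           ∎))
    pʳ∣[h-1][h+1] : + (p ^ suc r) S.∣ (h - 1ℤ) * (h + 1ℤ)
    pʳ∣[h-1][h+1] = subst (+ (p ^ suc r) S.∣_) (trans (cong (_- 1ℤ) gᵉ≡h*h) (difference-of-squares h))
                          (S.∣ᵤ⇒∣ pʳ∣gᵉ-1)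
      where
      gᵉ≡h*h : g ^ℤ e ≡ h * (h * 1ℤ)
      gᵉ≡h*h = trans (cong (g ^ℤ_) e≡f*2) (sym (^ℤ-*-assoc g f 2))
      difference-of-squares : ∀ h → h * (h * 1ℤ) - 1ℤ ≡ (h - 1ℤ) * (h + 1ℤ)
      difference-of-squares = solve-∀
    0<f : 0 < f
    0<f = ℕ.n≢0⇒n>0 λ { refl → ℕ.<⇒≢ 0<e (sym e≡f*2) }
    f<e : f < e
    f<e = subst (f <_) (sym e≡f*2) (ℕ.m<m*n f 2 {{ℕ.>-nonZero 0<f}} (s≤s (s≤s z≤n)))

  Separates : ∀ {k} → ℤ → (ℤ → Fin k) → Set
  Separates g χ = ∀ {Y Z} → ¬ + p S.∣ Y → Z ≈ g * Y → χ Z ≢ χ Y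

-- Positions on the orbits of multiplication by g modulo p

module Orbit {p : ℕ} (p-prime : Prime p) {g : ℤ} {d : ℕ} (ord : Congruence.IsOrder p g d) where

  open ModPrime p-prime
  open IsOrder ord

  OnOrbit : ℤ → ℕ → Set
  OnOrbit Y r = ∃ λ i → i < d × g ^ℤ i * Y ≈ + r

  -- the least residue on the orbit of Y
  base : ∀ Y → Least (OnOrbit Y)
  base Y = least-from (λ r → ℕ.anyUpTo? (λ i → g ^ℤ i * Y ≈? + r) d)
                      (0 , positive , ≈-trans (≈-reflexive (ℤ.*-identityˡ Y)) (≈-%ℕ Y))

  ReachesBase : ℤ → ℕ → Set
  ReachesBase Y j = g ^ℤ j * Y ≈ + value (base Y)

  fewest-steps : ∀ Y → Least (ReachesBase Y)
  fewest-steps Y = let i , _ , gⁱY≈base = Least.holds (base Y) in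
    least-from (λ j → g ^ℤ j * Y ≈? + value (base Y)) {i} gⁱY≈base

  index : ℤ → ℕ
  index Y = value (fewest-steps Y)

  instance
    d≢0 : NonZero d
    d≢0 = ℕ.>-nonZero positive

  private
    shift : ∀ i Y → g ^ℤ i * (g * Y) ≡ g ^ℤ suc i * Y
    shift i Y = reassoc g (g ^ℤ i) Y
      where
      reassoc : ∀ g x Y → x * (g * Y) ≡ g * x * Y
      reassoc = solve-∀

    full-turn : ∀ Y → g ^ℤ d * Y ≈ Y
    full-turn Y = ≈-trans (*-congʳ Y returns) (≈-reflexive (ℤ.*-identityˡ Y))

    last-step : ∀ Y → g ^ℤ ℕ.pred d * (g * Y) ≈ Y
    last-step Y = ≈-trans (≈-reflexive (trans (shift (ℕ.pred d) Y) (cong (λ k → g ^ℤ k * Y) (ℕ.suc-pred d))))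
                          (full-turn Y)

  OnOrbit-cong : ∀ {Y Y′ r} → Y ≈ Y′ → OnOrbit Y r → OnOrbit Y′ r
  OnOrbit-cong {Y} {Y′} Y≈Y′ (i , i<d , gⁱY≈r) = i , i<d , ≈-trans (*-congˡ (g ^ℤ i) (≈-sym Y≈Y′)) gⁱY≈r

  OnOrbit-step : ∀ {Y r} → OnOrbit (g * Y) r → OnOrbit Y r
  OnOrbit-step {Y} {r} (i , i<d , gⁱgY≈r) with ℕ.m≤n⇒m<n∨m≡n i<d
  ... | inj₁ 1+i<d = suc i , 1+i<d , ≈-trans (≈-reflexive (sym (shift i Y))) gⁱgY≈r
  ... | inj₂ 1+i≡d = 0 , positive , (begin
    1ℤ * Y            ≡⟨ ℤ.*-identityˡ Y ⟩
    Y                 ≈⟨ full-turn Y ⟨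
    g ^ℤ d * Y        ≡⟨ cong (λ k → g ^ℤ k * Y) 1+i≡d ⟨
    g ^ℤ suc i * Y    ≡⟨ shift i Y ⟨
    g ^ℤ i * (g * Y)  ≈⟨ gⁱgY≈r ⟩
    + r               ∎)
    where open import Relation.Binary.Reasoning.Setoid ≈-setoid

  OnOrbit-unstep : ∀ {Y r} → OnOrbit Y r → OnOrbit (g * Y) r
  OnOrbit-unstep {Y} (zero , _ , Y≈r) =
    ℕ.pred d , ℕ.≤-reflexive (ℕ.suc-pred d) ,
    ≈-trans (last-step Y) (≈-trans (≈-reflexive (sym (ℤ.*-identityˡ Y))) Y≈r)
  OnOrbit-unstep {Y} (suc i , 1+i<d , gⁱ⁺¹Y≈r) =
    i , ℕ.<-trans (ℕ.n<1+n i) 1+i<d , ≈-trans (≈-reflexive (shift i Y)) gⁱ⁺¹Y≈r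

  base-cong : ∀ {Y Y′} → Y ≈ Y′ → value (base Y) ≡ value (base Y′)
  base-cong {Y} {Y′} Y≈Y′ =
    least-unique (least-map (OnOrbit-cong Y≈Y′) (OnOrbit-cong (≈-sym Y≈Y′)) (base Y)) (base Y′)

  base-step : ∀ Y → value (base (g * Y)) ≡ value (base Y)
  base-step Y = least-unique (least-map OnOrbit-step OnOrbit-unstep (base (g * Y))) (base Y)

  index-cong : ∀ {Y Y′} → Y ≈ Y′ → index Y ≡ index Y′
  index-cong {Y} {Y′} Y≈Y′ =
    least-unique (least-map (λ {j} → move {j = j} Y≈Y′) (λ {j} → move {j = j} (≈-sym Y≈Y′)) (fewest-steps Y))
                 (fewest-steps Y′)
    where
    move : ∀ {Y Y′ j} → Y ≈ Y′ → ReachesBase Y j → ReachesBase Y′ j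
    move {j = j} Y≈Y′ gʲY≈b = ≈-trans (*-congˡ (g ^ℤ j) (≈-sym Y≈Y′))
                                      (≈-trans gʲY≈b (≈-reflexive (cong +_ (base-cong Y≈Y′))))

  index-unique : ∀ {Y j} → ReachesBase Y j → (∀ {i} → i < j → ¬ ReachesBase Y i) → index Y ≡ j
  index-unique {Y} {j} gʲY≈b below = least-unique (fewest-steps Y) (least j gʲY≈b below)

  index-step : ∀ {Y} → ¬ + p S.∣ Y → CyclicPredecessor d (index (g * Y)) (index Y)
  index-step {Y} p∤Y = by-fewest-steps (fewest-steps Y)
    where
    by-fewest-steps : (l : Least (ReachesBase Y)) → CyclicPredecessor d (index (g * Y)) (value l)
    by-fewest-steps (least (suc j) gʲ⁺¹Y≈b below) = inj₁ (cong suc (index-unique {g * Y} {j} gʲgY≈b below′))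
      where
      gʲgY≈b : ReachesBase (g * Y) j
      gʲgY≈b = ≈-trans (≈-reflexive (shift j Y)) (≈-trans gʲ⁺¹Y≈b (≈-reflexive (cong +_ (sym (base-step Y)))))
      below′ : ∀ {i} → i < j → ¬ ReachesBase (g * Y) i
      below′ {i} i<j gⁱgY≈b =
        below (s≤s i<j)
          (≈-trans (≈-reflexive (sym (shift i Y))) (≈-trans gⁱgY≈b (≈-reflexive (cong +_ (base-step Y)))))
    by-fewest-steps (least zero Y≈b _) =
      inj₂ (refl , trans (cong suc (index-unique {g * Y} {ℕ.pred d} gᵈ⁻¹gY≈b below′)) (ℕ.suc-pred d))
      where
      open import Relation.Binary.Reasoning.Setoid ≈-setoid
      b≈Y : + value (base (g * Y)) ≈ Y
      b≈Y = begin
        + value (base (g * Y))  ≡⟨ cong +_ (base-step Y) ⟩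
        + value (base Y)        ≈⟨ Y≈b ⟨
        1ℤ * Y                  ≡⟨ ℤ.*-identityˡ Y ⟩
        Y                       ∎
      gᵈ⁻¹gY≈b : ReachesBase (g * Y) (ℕ.pred d)
      gᵈ⁻¹gY≈b = ≈-trans (last-step Y) (≈-sym b≈Y)
      below′ : ∀ {i} → i < ℕ.pred d → ¬ ReachesBase (g * Y) i
      below′ {i} i<d-1 gⁱgY≈b = minimal (s≤s z≤n) (subst (suc (suc i) ≤_) (ℕ.suc-pred d) (s≤s i<d-1))
        (*-cancelʳ-≈ p∤Y (begin
          g ^ℤ suc i * Y     ≡⟨ shift i Y ⟨
          g ^ℤ i * (g * Y)   ≈⟨ gⁱgY≈b ⟩
          + value (base (g * Y)) ≈⟨ b≈Y ⟩
          Y                  ≡⟨ ℤ.*-identityˡ Y ⟨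
          1ℤ * Y             ∎))

  index-separates : ∀ {k} (colour : ℕ → Fin k) →
                    (∀ {i j} → CyclicPredecessor d i j → colour i ≢ colour j) →
                    Separates g (colour ∘′ index)
  index-separates colour proper {Y} {Z} p∤Y Z≈gY colourZ≡colourY =
    proper {index (g * Y)} {index Y} (index-step p∤Y)
      (trans (cong colour (sym (index-cong {Z} {g * Y} Z≈gY))) colourZ≡colourY)

-- Colouring n = pᵛ u by the parity of ⌊v / r⌋ and a colour of the unit u

module LayeredColouring {p : ℕ} (p-prime : Prime p) (r : ℕ) .{{_ : NonZero r}} {k : ℕ} (χ : ℤ → Fin k) where

  open ModPrime p-prime

  private
    split : ∀ n → PSplit p (suc n)
    split n = p-split 1<p (suc n) (s≤s z≤n)

  valuation : ℕ → ℕ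
  valuation n = PSplit.exponent (split n)

  unit : ℕ → ℤ
  unit n = + PSplit.cofactor (split n)

  unit-coprime : ∀ n → ¬ + p S.∣ unit n
  unit-coprime n = PSplit.coprime (split n) ∘′ S.∣⇒∣ᵤ

  splits : ∀ n → + suc n ≡ + (p ^ valuation n) * unit n
  splits n = trans (cong +_ (PSplit.splits (split n))) (ℤ.pos-* (p ^ valuation n) (PSplit.cofactor (split n)))

  layer : ℕ → Fin 2
  layer n = (valuation n ℕ./ r) ℕ.mod 2

  -- 0 is not a positive integer; its colour is irrelevant
  colouring : ℕ → Fin (2 ℕ.* k)
  colouring zero    = Fin.combine (0 ℕ.mod 2) (χ 0ℤ)
  colouring (suc n) = Fin.combine (layer n) (χ (unit n))

  layer-step : ∀ v w → v ≡ r ℕ.+ w → (v ℕ./ r) ℕ.mod 2 ≢ (w ℕ./ r) ℕ.mod 2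
  layer-step v w refl layers-equal = suc-mod-2 (w ℕ./ r) (trans (cong (ℕ._mod 2) (sym quotient-step)) layers-equal)
    where
    open ≡-Reasoning
    quotient-step : (r ℕ.+ w) ℕ./ r ≡ suc (w ℕ./ r)
    quotient-step = begin
      (r ℕ.+ w) ℕ./ r       ≡⟨ ℕ.+-distrib-/-∣ˡ w (ℕD.∣-refl {r}) ⟩
      r ℕ./ r ℕ.+ w ℕ./ r   ≡⟨ cong (ℕ._+ w ℕ./ r) (ℕ.n/n≡1 r) ⟩
      suc (w ℕ./ r)         ∎

  -- p ∣ b′ Y + c′ Z together with p ∣ g c′ + b′ says Z ≈ g Y, once c′ is cancelled
  solution-colours-differ : ∀ {b′ c′ g Y Z} → ¬ + p S.∣ c′ → + p S.∣ g * c′ + b′ → Separates g χ →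
                            ¬ + p S.∣ Y → + p S.∣ b′ * Y + c′ * Z → χ Y ≢ χ Z
  solution-colours-differ {b′} {c′} {g} {Y} {Z} p∤c′ p∣gc′+b′ separates p∤Y p∣b′Y+c′Z =
    separates p∤Y Z≈gY ∘′ sym
    where
    factor : ∀ b′ c′ g Y Z → (b′ * Y + c′ * Z) - Y * (g * c′ + b′) ≡ Z * c′ - g * Y * c′
    factor = solve-∀
    Z≈gY : Z ≈ g * Y
    Z≈gY = *-cancelʳ-≈ p∤c′ (mk≈ (subst (+ p S.∣_) (factor b′ c′ g Y Z)
                                        (S.∣m∣n⇒∣m-n p∣b′Y+c′Z (S.∣n⇒∣m*n Y p∣gc′+b′))))

  no-monochromatic-solution : ∀ {a b c b′ c′ g} → ¬ + p S.∣ a → ¬ + p S.∣ b′ → ¬ + p S.∣ c′ →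
                              b ≡ + (p ^ r) * b′ → c ≡ + (p ^ r) * c′ →
                              + p S.∣ g * c′ + b′ → Separates g χ → ¬ MonoSol a b c colouring
  no-monochromatic-solution {a} {b} {c} {b′} {c′} {g} p∤a p∤b′ p∤c′ refl refl p∣gc′+b′ separates
    (suc x , suc y , suc z , _ , _ , _ , x~y , y~z , sum≡0) =
    solution-colours-differ {b′} {c′} {g} p∤c′ p∣gc′+b′ separates (unit-coprime y) (proj₂ valuations) χY≡χZ
    where
    vx vy vz : ℕ
    vx = valuation x
    vy = valuation y
    vz = valuation z
    X Y Z : ℤ
    X = unit x
    Y = unit y
    Z = unit z
    layerx≡layery : layer x ≡ layer y
    layerx≡layery = proj₁ (Fin.combine-injective (layer x) (χ X) (layer y) (χ Y) x~y)
    layery≡layerz : layer y ≡ layer z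
    layery≡layerz = proj₁ (Fin.combine-injective (layer y) (χ Y) (layer z) (χ Z) y~z)
    χY≡χZ : χ Y ≡ χ Z
    χY≡χZ = proj₂ (Fin.combine-injective (layer y) (χ Y) (layer z) (χ Z) y~z)
    separated-sum≡0 : + (p ^ vx) * (a * X) + + (p ^ (r ℕ.+ vy)) * (b′ * Y) + + (p ^ (r ℕ.+ vz)) * (c′ * Z) ≡ 0ℤ
    separated-sum≡0 = begin
      P vx * (a * X) + P (r ℕ.+ vy) * (b′ * Y) + P (r ℕ.+ vz) * (c′ * Z)
        ≡⟨ cong₂ (λ u w → P vx * (a * X) + u * (b′ * Y) + w * (c′ * Z)) (P-+ r vy) (P-+ r vz) ⟩
      P vx * (a * X) + P r * P vy * (b′ * Y) + P r * P vz * (c′ * Z)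
        ≡⟨ regroup a (P vx) X (P r) b′ (P vy) Y c′ (P vz) Z ⟩
      a * (P vx * X) + P r * b′ * (P vy * Y) + P r * c′ * (P vz * Z)
        ≡⟨ cong₂ (λ u w → a * u + P r * b′ * w + P r * c′ * (P vz * Z)) (splits x) (splits y) ⟨
      a * + suc x + P r * b′ * + suc y + P r * c′ * (P vz * Z)
        ≡⟨ cong (λ u → a * + suc x + P r * b′ * + suc y + P r * c′ * u) (splits z) ⟨
      a * + suc x + P r * b′ * + suc y + P r * c′ * + suc z
        ≡⟨ sum≡0 ⟩
      0ℤ ∎
      where
      open ≡-Reasoning
      P : ℕ → ℤ
      P n = + (p ^ n)
      P-+ : ∀ m n → P (m ℕ.+ n) ≡ P m * P n
      P-+ m n = trans (cong +_ (ℕ.^-distribˡ-+-* p m n)) (ℤ.pos-* (p ^ m) (p ^ n))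
      regroup : ∀ a Px X Pr b′ Py Y c′ Pz Z →
                Px * (a * X) + Pr * Py * (b′ * Y) + Pr * Pz * (c′ * Z) ≡
                a * (Px * X) + Pr * b′ * (Py * Y) + Pr * c′ * (Pz * Z)
      regroup = solve-∀
    valuations : r ℕ.+ vy ≡ r ℕ.+ vz × + p S.∣ b′ * Y + c′ * Z
    valuations = vanishing-sum (∤-* p∤a (unit-coprime x)) (∤-* p∤b′ (unit-coprime y)) (∤-* p∤c′ (unit-coprime z))
                               separated-sum≡0
                               (λ vx≡r+vy → layer-step vx vy vx≡r+vy layerx≡layery)
                               (λ vx≡r+vz → layer-step vx vz vx≡r+vz (trans layerx≡layery layery≡layerz))

dorLt-from-colouring : ∀ {a b c n} (colouring : ℕ → Fin n) → ¬ MonoSol a b c colouring → DorLt a b c n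
dorLt-from-colouring {n = n} colouring no-solution k _ k-regular with n ℕ.≤? k
... | no  n≰k = ℕ.≰⇒> n≰k
... | yes n≤k with x , y , z , 0<x , 0<y , 0<z , x~y , y~z , sum≡0 ← k-regular (λ x → Fin.inject≤ (colouring x) n≤k)
  = ⊥-elim (no-solution (x , y , z , 0<x , 0<y , 0<z , Fin.inject≤-injective n≤k n≤k _ _ x~y ,
                         Fin.inject≤-injective n≤k n≤k _ _ y~z , sum≡0))

module Bounds {p : ℕ} (p-prime : Prime p) {r : ℕ} (0<r : 0 < r) {a b c b′ c′ : ℤ}
              (p∤a : ¬ + p S.∣ a) (p∤b′ : ¬ + p S.∣ b′) (p∤c′ : ¬ + p S.∣ c′)
              (p∤b′+c′ : ¬ + p S.∣ b′ + c′)
              (b≡pʳb′ : b ≡ + (p ^ r) * b′) (c≡pʳc′ : c ≡ + (p ^ r) * c′) where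

  open ModPrime p-prime

  instance
    r≢0 : NonZero r
    r≢0 = ℕ.>-nonZero 0<r

  dorLt-from-cycle-colouring : ∀ {g d k} (colour : ℕ → Fin k) → + p S.∣ g * c′ + b′ → (ord : IsOrder g d) →
                               (∀ {i j} → CyclicPredecessor d i j → colour i ≢ colour j) →
                               DorLt a b c (2 ℕ.* k)
  dorLt-from-cycle-colouring {g} colour p∣gc′+b′ ord proper =
    dorLt-from-colouring {a} {b} {c} colouring
      (no-monochromatic-solution {a} {b} {c} {b′} {c′} {g} p∤a p∤b′ p∤c′ b≡pʳb′ c≡pʳc′ p∣gc′+b′
                                 (index-separates colour proper))
    where
    open Orbit p-prime ord
    open LayeredColouring p-prime r (colour ∘′ index)

  g≉1 : ∀ {g} → + p S.∣ g * c′ + b′ → ¬ g ≈ 1ℤ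
  g≉1 {g} p∣gc′+b′ g≈1 = p∤b′+c′ (≈0⇒∣ (begin
    b′ + c′         ≡⟨ ℤ.+-comm b′ c′ ⟩
    c′ + b′         ≡⟨ cong (_+ b′) (ℤ.*-identityˡ c′) ⟨
    1ℤ * c′ + b′    ≈⟨ +-cong (*-congʳ c′ g≈1) ≈-refl ⟨
    g * c′ + b′     ≈⟨ ∣⇒≈0 p∣gc′+b′ ⟩
    0ℤ              ∎))
    where open import Relation.Binary.Reasoning.Setoid ≈-setoid

  p∤g : ∀ {g} → + p S.∣ g * c′ + b′ → ¬ + p S.∣ g
  p∤g p∣gc′+b′ p∣g = p∤b′ (S.∣m+n∣m⇒∣n p∣gc′+b′ (S.∣m⇒∣m*n c′ p∣g))

  p∤2 : ¬ + p S.∣ + 2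
  p∤2 p∣2 =
    p∤b′+c′ (≈0⇒∣ (≈-trans (+-cong (p∣2⇒unit≈1 p∣2 p∤b′) (p∣2⇒unit≈1 p∣2 p∤c′)) (∣⇒≈0 p∣2)))

  dor<6 : DorLt a b c 6
  dor<6 = from-order (order (p∤g p∣gc′+b′))
    where
    n : ℕ
    n = proj₁ (period p∤c′)
    -- g ≈ - b′ / c′, using c′⁻¹ ≈ c′ⁿ
    g : ℤ
    g = - (b′ * c′ ^ℤ n)
    p∣gc′+b′ : + p S.∣ g * c′ + b′
    p∣gc′+b′ = subst (+ p S.∣_) (expand b′ c′ (c′ ^ℤ n))
                     (S.∣n⇒∣m*n (- b′) (∣-difference (proj₂ (period p∤c′))))
      where
      expand : ∀ b′ c′ x → (- b′) * (c′ * x - 1ℤ) ≡ - (b′ * x) * c′ + b′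
      expand = solve-∀
    from-order : ∃ (IsOrder g) → DorLt a b c 6
    from-order (d , ord) =
      dorLt-from-cycle-colouring (cycle-colour d) p∣gc′+b′ ord (cycle-colour-proper (order≢1 ord (g≉1 p∣gc′+b′)))

  dor<4 : (Σ ℤ λ g → (+ (p ^ r) ∣ (g * c′ + b′)) × (Σ ℕ λ e → IsOrderMod (p ^ r) g e × (2 ℕD.∣ e))) →
          DorLt a b c 4
  dor<4 (g , pʳ∣gc′+b′ , e , ordʳ , 2∣e) = from-order (order (p∤g p∣gc′+b′))
    where
    p∣gc′+b′ : + p S.∣ g * c′ + b′
    p∣gc′+b′ = S.∣-trans (p∣p^ 0<r) (S.∣ᵤ⇒∣ pʳ∣gc′+b′)
    from-order : ∃ (IsOrder g) → DorLt a b c 4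
    from-order (d , ord) =
      dorLt-from-cycle-colouring (ℕ._mod 2) p∣gc′+b′ ord (parity-proper (even-order 0<r p∤2 ordʳ 2∣e ord))

lemma5 : (a b c : ℤ) → ¬ (a ≡ 0ℤ) → ¬ (b ≡ 0ℤ) → ¬ (c ≡ 0ℤ) →
         ¬ Regular a b c →
         (p r : ℕ) → Prime p → 0 < r →
         HasVal p a 0 → HasVal p b r → HasVal p c r → HasVal p (b + c) r →
         (b' c' : ℤ) → b ≡ + (p ^ r) * b' → c ≡ + (p ^ r) * c' →
         DorLt a b c 6 ×
         ((Σ ℤ λ g → (+ (p ^ r) ∣ (g * c' + b')) ×
             (Σ ℕ λ e → IsOrderMod (p ^ r) g e × (2 ℕD.∣ e)))
          → DorLt a b c 4)
lemma5 a b c _ _ _ _ p r p-prime 0<r val-a val-b val-c val-b+c b′ c′ b≡pʳb′ c≡pʳc′ = dor<6 , dor<4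
  where
  open ModPrime p-prime using (cofactor-coprime)
  p∤a : ¬ + p S.∣ a
  p∤a = cofactor-coprime {0} val-a (sym (ℤ.*-identityˡ a))
  p∤b′ : ¬ + p S.∣ b′
  p∤b′ = cofactor-coprime {r} val-b b≡pʳb′
  p∤c′ : ¬ + p S.∣ c′
  p∤c′ = cofactor-coprime {r} val-c c≡pʳc′
  p∤b′+c′ : ¬ + p S.∣ b′ + c′
  p∤b′+c′ = cofactor-coprime {r} val-b+c
              (trans (cong₂ _+_ b≡pʳb′ c≡pʳc′) (sym (ℤ.*-distribˡ-+ (+ (p ^ r)) b′ c′)))
  open Bounds p-prime 0<r p∤a p∤b′ p∤c′ p∤b′+c′ b≡pʳb′ c≡pʳc′
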